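{- Let $\lambda\neq0$ be real. For every integer $n\ge 0$, $$\beta_{n,\lambda}=\sum_{k=0}^{n}\frac{\lambda^{k}(1)_{k+1,\frac{1}{\lambda}}}{k+1}S_{2,\lambda}(n,k),$$ and $$\frac{(1)_{n+1,\frac{1}{\lambda}}}{n+1}\lambda^{n}=\sum_{k=0}^{n}\beta_{k,\lambda}S_{1,\lambda}(n,k).$$
   Context: For real $x$ and nonzero real $\mu$, $(x)_{0,\mu}=1$ and $(x)_{n,\mu}=x(x-\mu)\cdots(x-(n-1)\mu)$ for $n\ge1$ (used with $\mu=\lambda$ and $\mu=1/\lambda$). The degenerate exponential is $e_\lambda^x(t)=(1+\lambda t)^{x/\lambda}=\sum_{k\ge0}(x)_{k,\lambda}\frac{t^k}{k!}$, $e_\lambda(t)=e_\lambda^1(t)$, and the degenerate logarithm is its compositional inverse $\log_\lambda(1+t)=\frac{1}{\lambda}((1+t)^\lambda-1)$. The degenerate Stirling numbers of the second kind $S_{2,\lambda}(n,k)$ and of the first kind $S_{1,\lambda}(n,k)$ are defined by $\frac{1}{k!}(e_\lambda(t)-1)^k=\sum_{n\ge k}S_{2,\lambda}(n,k)\frac{t^n}{n!}$ and $\frac{1}{k!}(\log_\lambda(1+t))^k=\sum_{n\ge k}S_{1,\lambda}(n,k)\frac{t^n}{n!}$ for $k\ge0$ (with both equal to $0$ for $n<k$). The degenerate Bernoulli numbers $\beta_{n,\lambda}$ are defined by $\frac{t}{e_\lambda(t)-1}=\sum_{n\ge0}\beta_{n,\lambda}\frac{t^n}{n!}$. -}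

module Defs where

open import Level using (Level)
open import Data.Nat using (ℕ; zero; suc; _∸_)
open import Algebra.Bundles using (CommutativeRing)

-- All notions of the paper, over an arbitrary commutative ring R equipped
-- with a (total) function inv, meant to be a multiplicative inverse on
-- nonzero elements (the field axioms are hypotheses of the theorem).
module Degenerate {c ℓ : Level} (R : CommutativeRing c ℓ)
                  (inv : CommutativeRing.Carrier R → CommutativeRing.Carrier R) where

  open CommutativeRing R

  ι : ℕ → Carrier
  ι zero    = 0#
  ι (suc n) = 1# + ι n

  pow : Carrier → ℕ → Carrier
  pow x zero    = 1#
  pow x (suc n) = pow x n * x

  fact : ℕ → Carrier
  fact zero    = 1#
  fact (suc n) = fact n * ι (suc n)

  fall : Carrier → Carrier → ℕ → Carrier
  fall x μ zero    = 1#
  fall x μ (suc n) = fall x μ n * (x - ι n * μ)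

  sumTo : ℕ → (ℕ → Carrier) → Carrier
  sumTo zero    f = f 0
  sumTo (suc n) f = sumTo n f + f (suc n)

  -- formal power series: f n is the coefficient of t^n
  Series : Set c
  Series = ℕ → Carrier

  _⊛_ : Series → Series → Series
  (f ⊛ g) n = sumTo n (λ i → f i * g (n ∸ i))

  _^ˢ_ : Series → ℕ → Series
  (f ^ˢ zero) zero    = 1#
  (f ^ˢ zero) (suc n) = 0#
  (f ^ˢ suc k)        = (f ^ˢ k) ⊛ f

  oneˢ : Series
  oneˢ zero    = 1#
  oneˢ (suc n) = 0#

  eˣ : Carrier → Carrier → Series
  eˣ lam x k = fall x lam k * inv (fact k)

  eMinus1 : Carrier → Series
  eMinus1 lam zero    = 0#
  eMinus1 lam (suc k) = eˣ lam 1# (suc k)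

  -- log_λ(1+t) = (1/λ) ((1+t)^λ - 1), where (1+t)^λ = e_1^λ(t)
  logλ : Carrier → Series
  logλ lam zero    = 0#
  logλ lam (suc k) = inv lam * eˣ 1# lam (suc k)

  S₂ : Carrier → ℕ → ℕ → Carrier
  S₂ lam n k = fact n * (inv (fact k) * ((eMinus1 lam ^ˢ k) n))

  S₁ : Carrier → ℕ → ℕ → Carrier
  S₁ lam n k = fact n * (inv (fact k) * ((logλ lam ^ˢ k) n))

  -- β is the sequence of degenerate Bernoulli numbers:
  --   t/(e_λ(t)-1) = Σ_n β_n t^n/n!,  i.e.
  --   (Σ_n β_n t^n/n!) · ((e_λ(t)-1)/t) = 1  as formal power series
  IsDegBernoulli : Carrier → (ℕ → Carrier) → Set ℓ
  IsDegBernoulli lam β =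
    ∀ n → ((λ m → β m * inv (fact m)) ⊛ (λ m → eMinus1 lam (suc m))) n ≈ oneˢ n

{-# OPTIONS --safe #-}
-- E = e_λ(t) − 1 and L = log_λ(1 + t) satisfy (1 + λt) E′ = 1 + E and
-- (1 + t) L′ = 1 + λL.  Differentiating powers turns these into recurrences
-- for the coefficients of Eʲ and Lᵏ, and an induction on the degree shows
-- E(L(t)) = L(E(t)) = t coefficientwise, with no composition of series needed.
-- Hence t/(e_λ(t) − 1) = L(s)/s at s = E(t): expanding in the powers Eᵏ gives
-- the S₂ formula, and substituting t := L(t) gives L(t)/t, whose coefficients
-- [t^(n+1)] L = λⁿ (1)_{n+1,1/λ} / (n+1)! give the S₁ formula.
module Submission where

open import Defs
open import Level using (Level)
open import Data.Nat.Base as ℕ using (ℕ; zero; suc; _∸_; z≤n; s≤s)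
import Data.Nat.Properties as ℕₚ
open import Data.Sum.Base using (inj₁; inj₂)
open import Data.Product.Base using (_×_; _,_)
open import Data.Maybe.Base using (Maybe; nothing; just)
open import Relation.Nullary using (¬_; yes; no)
open import Relation.Binary.PropositionalEquality as ≡ using (_≡_)
open import Algebra.Bundles using (CommutativeRing; RawRing)
open import Algebra.Solver.Ring.AlmostCommutativeRing
  using (AlmostCommutativeRing; fromCommutativeRing; -raw-almostCommutative⟶; _-Raw-AlmostCommutative⟶_)
import Algebra.Solver.Ring as RingSolver

module _ {c ℓ : Level} (R : CommutativeRing c ℓ)
         (inv : CommutativeRing.Carrier R → CommutativeRing.Carrier R) where

  open CommutativeRing R
  open Degenerate R inv
  open import Relation.Binary.Reasoning.Setoid setoid
  open import Algebra.Properties.Ring ring using (-‿distribˡ-*; -‿distribʳ-*; -‿involutive)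
  open import Algebra.Properties.AbelianGroup +-abelianGroup using (⁻¹-∙-comm)
  open import Algebra.Properties.Group +-group using () renaming (∙-cancelˡ to +-cancelˡ)

  ι-homo-+ : ∀ m n → ι (m ℕ.+ n) ≈ ι m + ι n
  ι-homo-+ zero    n = sym (+-identityˡ _)
  ι-homo-+ (suc m) n = trans (+-congˡ (ι-homo-+ m n)) (sym (+-assoc _ _ _))

  ι-homo-* : ∀ m n → ι (m ℕ.* n) ≈ ι m * ι n
  ι-homo-* zero    n = sym (zeroˡ _)
  ι-homo-* (suc m) n = begin
    ι (n ℕ.+ m ℕ.* n)     ≈⟨ ι-homo-+ n (m ℕ.* n) ⟩
    ι n + ι (m ℕ.* n)     ≈⟨ +-congˡ (ι-homo-* m n) ⟩
    ι n + ι m * ι n       ≈⟨ +-congʳ (sym (*-identityˡ _)) ⟩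
    1# * ι n + ι m * ι n  ≈⟨ sym (distribʳ _ _ _) ⟩
    (1# + ι m) * ι n      ∎

  private
    ACR : AlmostCommutativeRing c ℓ
    ACR = fromCommutativeRing R

  open RingSolver (AlmostCommutativeRing.rawRing ACR) ACR (-raw-almostCommutative⟶ ACR) (λ _ _ → nothing)
    using () renaming (solve to solveᶜ; _:+_ to _+ᶜ_; _:*_ to _*ᶜ_; _:-_ to _-ᶜ_; _:=_ to _=ᶜ_)

  difference-* : ∀ a b c d → (a - b) * (c - d) ≈ (a * c + b * d) - (a * d + b * c)
  difference-* a b c d = begin
    (a - b) * (c - d)
      ≈⟨ solveᶜ 4 (λ a b′ c d′ → (a +ᶜ b′) *ᶜ (c +ᶜ d′) =ᶜ (a *ᶜ c +ᶜ b′ *ᶜ d′) +ᶜ (a *ᶜ d′ +ᶜ b′ *ᶜ c))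
                  refl a (- b) c (- d) ⟩
    (a * c + - b * - d) + (a * - d + - b * c)
      ≈⟨ +-cong (+-congˡ neg*neg) (+-cong (sym (-‿distribʳ-* a d)) (sym (-‿distribˡ-* b c))) ⟩
    (a * c + b * d) + (- (a * d) + - (b * c))
      ≈⟨ +-congˡ (⁻¹-∙-comm _ _) ⟩
    (a * c + b * d) - (a * d + b * c) ∎
    where
    neg*neg : - b * - d ≈ b * d
    neg*neg = trans (sym (-‿distribˡ-* b (- d))) (trans (-‿cong (sym (-‿distribʳ-* b d))) (-‿involutive _))

  difference-cong : ∀ x y z w → x + w ≈ z + y → x - y ≈ z - w
  difference-cong x y z w e = begin
    x - y                   ≈⟨ sym (+-identityʳ _) ⟩
    (x - y) + 0#            ≈⟨ +-congˡ (sym (-‿inverseʳ w)) ⟩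
    (x - y) + (w - w)       ≈⟨ solveᶜ 4 (λ x y′ w w′ → (x +ᶜ y′) +ᶜ (w +ᶜ w′) =ᶜ (x +ᶜ w) +ᶜ (y′ +ᶜ w′)) refl x (- y) w (- w) ⟩
    (x + w) + (- y - w)     ≈⟨ +-congʳ e ⟩
    (z + y) + (- y - w)     ≈⟨ solveᶜ 4 (λ z y y′ w′ → (z +ᶜ y) +ᶜ (y′ +ᶜ w′) =ᶜ (z +ᶜ (y +ᶜ y′)) +ᶜ w′) refl z y (- y) (- w) ⟩
    (z + (y - y)) - w       ≈⟨ +-congʳ (trans (+-congˡ (-‿inverseʳ y)) (+-identityʳ z)) ⟩
    z - w                   ∎

  -- The integers as formal differences (a , b) ↦ a − b.  Used as the solver's
  -- coefficient ring, so that cancellations such as x − x = 0 are decided.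
  DifferenceRing : RawRing _ _
  DifferenceRing = record
    { Carrier = ℕ × ℕ ; _≈_ = _≡_
    ; _+_ = λ { (a , b) (c , d) → (a ℕ.+ c , b ℕ.+ d) }
    ; _*_ = λ { (a , b) (c , d) → (a ℕ.* c ℕ.+ b ℕ.* d , a ℕ.* d ℕ.+ b ℕ.* c) }
    ; -_ = λ { (a , b) → (b , a) }
    ; 0# = (0 , 0) ; 1# = (1 , 0) }

  -- The two special clauses make 0# and 1# preserved definitionally.
  ⟦_⟧ᵈ : ℕ × ℕ → Carrier
  ⟦ (zero , zero) ⟧ᵈ     = 0#
  ⟦ (suc zero , zero) ⟧ᵈ = 1#
  ⟦ (a , b) ⟧ᵈ           = ι a - ι b

  ⟦⟧ᵈ-difference : ∀ a b → ⟦ (a , b) ⟧ᵈ ≈ ι a - ι b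
  ⟦⟧ᵈ-difference zero          zero    = sym (-‿inverseʳ 0#)
  ⟦⟧ᵈ-difference zero          (suc b) = refl
  ⟦⟧ᵈ-difference (suc zero)    zero    = sym (trans (+-congʳ (+-identityʳ 1#)) 1-0≈1)
    where
    1-0≈1 : 1# - 0# ≈ 1#
    1-0≈1 = trans (+-congˡ (trans (sym (+-identityˡ _)) (-‿inverseʳ 0#))) (+-identityʳ 1#)
  ⟦⟧ᵈ-difference (suc zero)    (suc b) = refl
  ⟦⟧ᵈ-difference (suc (suc a)) b       = refl

  ⟦⟧ᵈ-homo-+ : ∀ a b c d → ⟦ (a ℕ.+ c , b ℕ.+ d) ⟧ᵈ ≈ ⟦ (a , b) ⟧ᵈ + ⟦ (c , d) ⟧ᵈ
  ⟦⟧ᵈ-homo-+ a b c d = begin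
    ⟦ (a ℕ.+ c , b ℕ.+ d) ⟧ᵈ   ≈⟨ ⟦⟧ᵈ-difference (a ℕ.+ c) (b ℕ.+ d) ⟩
    ι (a ℕ.+ c) - ι (b ℕ.+ d)  ≈⟨ +-cong (ι-homo-+ a c) (-‿cong (ι-homo-+ b d)) ⟩
    (ι a + ι c) - (ι b + ι d)
      ≈⟨ solveᶜ 4 (λ a b c d → (a +ᶜ c) -ᶜ (b +ᶜ d) =ᶜ (a -ᶜ b) +ᶜ (c -ᶜ d)) refl (ι a) (ι b) (ι c) (ι d) ⟩
    (ι a - ι b) + (ι c - ι d)  ≈⟨ sym (+-cong (⟦⟧ᵈ-difference a b) (⟦⟧ᵈ-difference c d)) ⟩
    ⟦ (a , b) ⟧ᵈ + ⟦ (c , d) ⟧ᵈ ∎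

  ⟦⟧ᵈ-homo-* : ∀ a b c d →
    ⟦ (a ℕ.* c ℕ.+ b ℕ.* d , a ℕ.* d ℕ.+ b ℕ.* c) ⟧ᵈ ≈ ⟦ (a , b) ⟧ᵈ * ⟦ (c , d) ⟧ᵈ
  ⟦⟧ᵈ-homo-* a b c d = begin
    ⟦ (a ℕ.* c ℕ.+ b ℕ.* d , a ℕ.* d ℕ.+ b ℕ.* c) ⟧ᵈ
      ≈⟨ ⟦⟧ᵈ-difference (a ℕ.* c ℕ.+ b ℕ.* d) (a ℕ.* d ℕ.+ b ℕ.* c) ⟩
    ι (a ℕ.* c ℕ.+ b ℕ.* d) - ι (a ℕ.* d ℕ.+ b ℕ.* c)
      ≈⟨ +-cong (ι-homo-+* a c b d) (-‿cong (ι-homo-+* a d b c)) ⟩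
    (ι a * ι c + ι b * ι d) - (ι a * ι d + ι b * ι c)
      ≈⟨ sym (difference-* (ι a) (ι b) (ι c) (ι d)) ⟩
    (ι a - ι b) * (ι c - ι d)
      ≈⟨ sym (*-cong (⟦⟧ᵈ-difference a b) (⟦⟧ᵈ-difference c d)) ⟩
    ⟦ (a , b) ⟧ᵈ * ⟦ (c , d) ⟧ᵈ ∎
    where
    ι-homo-+* : ∀ w x y z → ι (w ℕ.* x ℕ.+ y ℕ.* z) ≈ ι w * ι x + ι y * ι z
    ι-homo-+* w x y z = trans (ι-homo-+ (w ℕ.* x) (y ℕ.* z)) (+-cong (ι-homo-* w x) (ι-homo-* y z))

  ⟦⟧ᵈ-homo-‿ : ∀ a b → ⟦ (b , a) ⟧ᵈ ≈ - ⟦ (a , b) ⟧ᵈ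
  ⟦⟧ᵈ-homo-‿ a b = begin
    ⟦ (b , a) ⟧ᵈ      ≈⟨ ⟦⟧ᵈ-difference b a ⟩
    ι b - ι a         ≈⟨ +-comm _ _ ⟩
    - ι a + ι b       ≈⟨ +-congˡ (sym (-‿involutive _)) ⟩
    - ι a - - ι b     ≈⟨ ⁻¹-∙-comm _ _ ⟩
    - (ι a - ι b)     ≈⟨ -‿cong (sym (⟦⟧ᵈ-difference a b)) ⟩
    - ⟦ (a , b) ⟧ᵈ    ∎

  ⟦⟧ᵈ-homomorphism : DifferenceRing -Raw-AlmostCommutative⟶ ACR
  ⟦⟧ᵈ-homomorphism = record
    { ⟦_⟧    = ⟦_⟧ᵈ
    ; +-homo = λ { (a , b) (c , d) → ⟦⟧ᵈ-homo-+ a b c d }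
    ; *-homo = λ { (a , b) (c , d) → ⟦⟧ᵈ-homo-* a b c d }
    ; -‿homo = λ { (a , b) → ⟦⟧ᵈ-homo-‿ a b }
    ; 0-homo = refl
    ; 1-homo = refl
    }

  ⟦⟧ᵈ-weaklyDecidable : ∀ x y → Maybe (⟦ x ⟧ᵈ ≈ ⟦ y ⟧ᵈ)
  ⟦⟧ᵈ-weaklyDecidable (a , b) (c , d) with a ℕ.+ d ℕₚ.≟ c ℕ.+ b
  ... | yes a+d≡c+b = just (begin
    ⟦ (a , b) ⟧ᵈ  ≈⟨ ⟦⟧ᵈ-difference a b ⟩
    ι a - ι b     ≈⟨ difference-cong (ι a) (ι b) (ι c) (ι d) ι-a+d≈ι-c+b ⟩
    ι c - ι d     ≈⟨ ⟦⟧ᵈ-difference c d ⟨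
    ⟦ (c , d) ⟧ᵈ  ∎)
    where
    ι-a+d≈ι-c+b : ι a + ι d ≈ ι c + ι b
    ι-a+d≈ι-c+b = trans (sym (ι-homo-+ a d)) (trans (reflexive (≡.cong ι a+d≡c+b)) (ι-homo-+ c b))
  ... | no _ = nothing

  open RingSolver DifferenceRing ACR ⟦⟧ᵈ-homomorphism ⟦⟧ᵈ-weaklyDecidable
    using (solve; Polynomial; con; _:+_; _:*_; _:-_; _:=_)

  :0 :1 : ∀ {n} → Polynomial n
  :0 = con (0 , 0)
  :1 = con (1 , 0)

  sumTo-cong : ∀ n {f g : ℕ → Carrier} → (∀ i → i ℕ.≤ n → f i ≈ g i) → sumTo n f ≈ sumTo n g
  sumTo-cong zero    f≈g = f≈g 0 z≤n
  sumTo-cong (suc n) f≈g = +-cong (sumTo-cong n (λ i i≤n → f≈g i (ℕₚ.m≤n⇒m≤1+n i≤n))) (f≈g (suc n) ℕₚ.≤-refl)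

  sumTo-distrib-+ : ∀ n (f g : ℕ → Carrier) → sumTo n (λ i → f i + g i) ≈ sumTo n f + sumTo n g
  sumTo-distrib-+ zero    f g = refl
  sumTo-distrib-+ (suc n) f g = trans (+-congʳ (sumTo-distrib-+ n f g))
    (solve 4 (λ a b c d → (a :+ b) :+ (c :+ d) := (a :+ c) :+ (b :+ d)) refl _ _ _ _)

  sumTo-*ˡ : ∀ n x (f : ℕ → Carrier) → sumTo n (λ i → x * f i) ≈ x * sumTo n f
  sumTo-*ˡ zero    x f = refl
  sumTo-*ˡ (suc n) x f = trans (+-congʳ (sumTo-*ˡ n x f)) (sym (distribˡ _ _ _))

  sumTo-*ʳ : ∀ n x (f : ℕ → Carrier) → sumTo n (λ i → f i * x) ≈ sumTo n f * x
  sumTo-*ʳ n x f = trans (sumTo-cong n (λ i _ → *-comm _ _)) (trans (sumTo-*ˡ n x f) (*-comm _ _))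

  sumTo-zero : ∀ n {f : ℕ → Carrier} → (∀ i → i ℕ.≤ n → f i ≈ 0#) → sumTo n f ≈ 0#
  sumTo-zero zero    f≈0 = f≈0 0 z≤n
  sumTo-zero (suc n) f≈0 =
    trans (+-cong (sumTo-zero n (λ i i≤n → f≈0 i (ℕₚ.m≤n⇒m≤1+n i≤n))) (f≈0 (suc n) ℕₚ.≤-refl)) (+-identityʳ 0#)

  sumTo-suc : ∀ n (f : ℕ → Carrier) → sumTo (suc n) f ≈ f 0 + sumTo n (λ i → f (suc i))
  sumTo-suc zero    f = refl
  sumTo-suc (suc n) f = trans (+-congʳ (sumTo-suc n f)) (+-assoc _ _ _)

  sumTo-suc-vanishing-head : ∀ n (f : ℕ → Carrier) → f 0 ≈ 0# → sumTo (suc n) f ≈ sumTo n (λ i → f (suc i))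
  sumTo-suc-vanishing-head n f f0≈0 = trans (sumTo-suc n f) (trans (+-congʳ f0≈0) (+-identityˡ _))

  sumTo-vanishing-last : ∀ n (f : ℕ → Carrier) → f (suc n) ≈ 0# → sumTo (suc n) f ≈ sumTo n f
  sumTo-vanishing-last n f fn≈0 = trans (+-congˡ fn≈0) (+-identityʳ _)

  sumTo-comm : ∀ n m (f : ℕ → ℕ → Carrier) →
    sumTo n (λ i → sumTo m (λ k → f i k)) ≈ sumTo m (λ k → sumTo n (λ i → f i k))
  sumTo-comm zero    m f = refl
  sumTo-comm (suc n) m f = trans (+-congʳ (sumTo-comm n m f)) (sym (sumTo-distrib-+ m _ _))

  sumTo-extend : ∀ {m n} (f : ℕ → Carrier) → m ℕ.≤ n → (∀ k → m ℕ.< k → k ℕ.≤ n → f k ≈ 0#) →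
    sumTo n f ≈ sumTo m f
  sumTo-extend f m≤n f≈0 with ℕₚ.m≤n⇒m<n∨m≡n m≤n
  ... | inj₂ ≡.refl = refl
  sumTo-extend {n = suc n} f _ f≈0 | inj₁ (s≤s m≤n) =
    trans (sumTo-vanishing-last n f (f≈0 (suc n) (s≤s m≤n) ℕₚ.≤-refl))
          (sumTo-extend f m≤n (λ k m<k k≤n → f≈0 k m<k (ℕₚ.m≤n⇒m≤1+n k≤n)))

  sumTo-triangle : ∀ n (g : ℕ → ℕ → Carrier) → (∀ j k → k ℕ.< j → g j k ≈ 0#) →
    sumTo n (λ k → sumTo k (λ j → g j k)) ≈ sumTo n (λ k → sumTo n (λ j → g j k))
  sumTo-triangle n g g≈0 = sumTo-cong n (λ k k≤n → sym (sumTo-extend (λ j → g j k) k≤n (λ j k<j _ → g≈0 j k k<j)))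

  δ : ℕ → ℕ → Carrier
  δ zero    zero    = 1#
  δ zero    (suc _) = 0#
  δ (suc _) zero    = 0#
  δ (suc m) (suc n) = δ m n

  δ-subst : ∀ (f : ℕ → Carrier) n j → f n * δ n j ≈ f j * δ n j
  δ-subst f zero    zero    = refl
  δ-subst f zero    (suc j) = trans (zeroʳ _) (sym (zeroʳ _))
  δ-subst f (suc n) zero    = trans (zeroʳ _) (sym (zeroʳ _))
  δ-subst f (suc n) (suc j) = δ-subst (λ m → f (suc m)) n j

  δ-diag : ∀ n → δ n n ≈ 1#
  δ-diag zero    = refl
  δ-diag (suc n) = δ-diag n

  δ-< : ∀ {j n} → j ℕ.< n → δ n j ≈ 0#
  δ-< {zero}  {suc n} _         = refl
  δ-< {suc j} {suc n} (s≤s j<n) = δ-< j<n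

  δ-sym : ∀ j n → δ j n ≈ δ n j
  δ-sym zero    zero    = refl
  δ-sym zero    (suc n) = refl
  δ-sym (suc j) zero    = refl
  δ-sym (suc j) (suc n) = δ-sym j n

  δ-zero : ∀ n → δ n 0 ≈ oneˢ n
  δ-zero zero    = refl
  δ-zero (suc n) = refl

  sumTo-δ : ∀ n (f : ℕ → Carrier) → sumTo n (λ j → f j * δ n j) ≈ f n
  sumTo-δ zero    f = *-identityʳ _
  sumTo-δ (suc n) f = trans (+-cong (sumTo-zero n (λ j j≤n → trans (*-congˡ (δ-< (s≤s j≤n))) (zeroʳ _)))
                                    (trans (*-congˡ (δ-diag n)) (*-identityʳ _)))
                            (+-identityˡ _)

  ⊛-congˡ : ∀ n {f g : Series} (h : Series) → (∀ i → f i ≈ g i) → (f ⊛ h) n ≈ (g ⊛ h) n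
  ⊛-congˡ n h f≈g = sumTo-cong n (λ i _ → *-congʳ (f≈g i))

  ⊛-congʳ : ∀ n (h : Series) {f g : Series} → (∀ i → f i ≈ g i) → (h ⊛ f) n ≈ (h ⊛ g) n
  ⊛-congʳ n h f≈g = sumTo-cong n (λ i _ → *-congˡ (f≈g (n ∸ i)))

  ⊛-distribʳ-+ : ∀ n (f g h : Series) → ((λ i → f i + g i) ⊛ h) n ≈ (f ⊛ h) n + (g ⊛ h) n
  ⊛-distribʳ-+ n f g h = trans (sumTo-cong n (λ i _ → distribʳ _ _ _)) (sumTo-distrib-+ n _ _)

  ⊛-distribˡ-+ : ∀ n (h f g : Series) → (h ⊛ (λ i → f i + g i)) n ≈ (h ⊛ f) n + (h ⊛ g) n
  ⊛-distribˡ-+ n h f g = trans (sumTo-cong n (λ i _ → distribˡ _ _ _)) (sumTo-distrib-+ n _ _)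

  ⊛-*ˡ : ∀ n x (f h : Series) → ((λ i → x * f i) ⊛ h) n ≈ x * (f ⊛ h) n
  ⊛-*ˡ n x f h = trans (sumTo-cong n (λ i _ → *-assoc _ _ _)) (sumTo-*ˡ n x _)

  ⊛-*ʳ : ∀ n x (h f : Series) → (h ⊛ (λ i → x * f i)) n ≈ x * (h ⊛ f) n
  ⊛-*ʳ n x h f = trans (sumTo-cong n (λ i _ → solve 3 (λ y x z → y :* (x :* z) := x :* (y :* z)) refl _ _ _))
                       (sumTo-*ˡ n x _)

  ⊛-suc : ∀ n (f g : Series) → (f ⊛ g) (suc n) ≈ sumTo n (λ i → f i * g (suc (n ∸ i))) + f (suc n) * g 0
  ⊛-suc n f g = +-cong (sumTo-cong n (λ i i≤n → reflexive (≡.cong (λ m → f i * g m) (ℕₚ.+-∸-assoc 1 i≤n))))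
                       (reflexive (≡.cong (λ m → f (suc n) * g m) (ℕₚ.n∸n≡0 n)))

  ⊛-identityʳ : ∀ n (f : Series) → (f ⊛ oneˢ) n ≈ f n
  ⊛-identityʳ zero    f = *-identityʳ _
  ⊛-identityʳ (suc n) f = begin
    (f ⊛ oneˢ) (suc n)                                  ≈⟨ ⊛-suc n f oneˢ ⟩
    sumTo n (λ i → f i * 0#) + f (suc n) * 1#           ≈⟨ +-cong (sumTo-zero n (λ i _ → zeroʳ _)) (*-identityʳ _) ⟩
    0# + f (suc n)                                      ≈⟨ +-identityˡ _ ⟩
    f (suc n)                                           ∎

  ⊛-cancelʳ : ∀ (f g D : Series) → D 0 ≈ 1# → (∀ n → (f ⊛ D) n ≈ (g ⊛ D) n) → ∀ n → f n ≈ g n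
  ⊛-cancelʳ f g D D0≈1 fD≈gD n = agree-below n n ℕₚ.≤-refl
    where
    *D0 : ∀ x → x * D 0 ≈ x
    *D0 x = trans (*-congˡ D0≈1) (*-identityʳ x)

    agree-below : ∀ n i → i ℕ.≤ n → f i ≈ g i
    agree-below zero zero z≤n = trans (sym (*D0 (f 0))) (trans (fD≈gD 0) (*D0 (g 0)))
    agree-below (suc n) i i≤1+n with ℕₚ.m≤n⇒m<n∨m≡n i≤1+n
    ... | inj₁ (s≤s i≤n) = agree-below n i i≤n
    ... | inj₂ ≡.refl    = trans (sym (*D0 _)) (trans (+-cancelˡ _ _ _ same-heads) (*D0 _))
      where
      heads : ℕ → Series → Carrier
      heads n h = sumTo n (λ i → h i * D (suc (n ∸ i)))

      same-heads : heads n f + f (suc n) * D 0 ≈ heads n f + g (suc n) * D 0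
      same-heads = begin
        heads n f + f (suc n) * D 0  ≈⟨ ⊛-suc n f D ⟨
        (f ⊛ D) (suc n)              ≈⟨ fD≈gD (suc n) ⟩
        (g ⊛ D) (suc n)              ≈⟨ ⊛-suc n g D ⟩
        heads n g + g (suc n) * D 0  ≈⟨ +-congʳ (sumTo-cong n (λ i i≤n → *-congʳ (agree-below n i i≤n))) ⟨
        heads n f + g (suc n) * D 0  ∎

  ι-∸-split : ∀ {i n} → i ℕ.≤ n → ι n ≈ ι i + ι (n ∸ i)
  ι-∸-split {i} {n} i≤n = trans (reflexive (≡.cong ι (≡.sym (ℕₚ.m+[n∸m]≡n i≤n)))) (ι-homo-+ i (n ∸ i))

  -- ∂ b f is the series (1 + b t) f′(t).
  ∂ : Carrier → Series → Series
  ∂ b f n = ι (suc n) * f (suc n) + b * ι n * f n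

  ∂-leibniz : ∀ b (f g : Series) n → ∂ b (f ⊛ g) n ≈ (∂ b f ⊛ g) n + (f ⊛ ∂ b g) n
  ∂-leibniz b f g n = begin
    ι (suc n) * (f ⊛ g) (suc n) + b * ι n * (f ⊛ g) n  ≈⟨ +-cong derivative-part linear-part ⟩
    (A₁ + A₂) + (B₁ + B₂)
      ≈⟨ solve 4 (λ a₁ a₂ b₁ b₂ → (a₁ :+ a₂) :+ (b₁ :+ b₂) := (a₁ :+ b₁) :+ (a₂ :+ b₂)) refl A₁ A₂ B₁ B₂ ⟩
    (A₁ + B₁) + (A₂ + B₂)
      ≈⟨ +-cong (⊛-distribʳ-+ n _ _ g) (⊛-distribˡ-+ n f (λ m → ι (suc m) * g (suc m)) (λ m → b * ι m * g m)) ⟨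
    (∂ b f ⊛ g) n + (f ⊛ ∂ b g) n ∎
    where
    A₁ = sumTo n (λ i → ι (suc i) * f (suc i) * g (n ∸ i))
    A₂ = sumTo n (λ i → f i * (ι (suc (n ∸ i)) * g (suc (n ∸ i))))
    B₁ = sumTo n (λ i → b * ι i * f i * g (n ∸ i))
    B₂ = sumTo n (λ i → f i * (b * ι (n ∸ i) * g (n ∸ i)))

    derivative-part : ι (suc n) * (f ⊛ g) (suc n) ≈ A₁ + A₂
    derivative-part = begin
      ι (suc n) * (f ⊛ g) (suc n)  ≈⟨ sumTo-*ˡ (suc n) _ _ ⟨
      sumTo (suc n) (λ i → ι (suc n) * (f i * g (suc n ∸ i)))
        ≈⟨ sumTo-cong (suc n) (λ i i≤1+n → trans (*-congʳ (ι-∸-split i≤1+n))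
             (solve 4 (λ a b x y → (a :+ b) :* (x :* y) := a :* x :* y :+ x :* (b :* y)) refl _ _ _ _)) ⟩
      sumTo (suc n) (λ i → ι i * f i * g (suc n ∸ i) + f i * (ι (suc n ∸ i) * g (suc n ∸ i)))
        ≈⟨ sumTo-distrib-+ (suc n) _ _ ⟩
      sumTo (suc n) (λ i → ι i * f i * g (suc n ∸ i)) + (f ⊛ (λ m → ι m * g m)) (suc n)
        ≈⟨ +-cong (sumTo-suc-vanishing-head n _ (trans (*-assoc _ _ _) (zeroˡ _)))
                  (trans (⊛-suc n f (λ m → ι m * g m)) (trans (+-congˡ (trans (*-congˡ (zeroˡ _)) (zeroʳ _))) (+-identityʳ _))) ⟩
      A₁ + A₂ ∎

    linear-part : b * ι n * (f ⊛ g) n ≈ B₁ + B₂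
    linear-part = begin
      b * ι n * (f ⊛ g) n  ≈⟨ sumTo-*ˡ n _ _ ⟨
      sumTo n (λ i → b * ι n * (f i * g (n ∸ i)))
        ≈⟨ sumTo-cong n (λ i i≤n → trans (*-congʳ (*-congˡ (ι-∸-split i≤n)))
             (solve 5 (λ b a c x y → b :* (a :+ c) :* (x :* y) := b :* a :* x :* y :+ x :* (b :* c :* y)) refl _ _ _ _ _)) ⟩
      sumTo n (λ i → b * ι i * f i * g (n ∸ i) + f i * (b * ι (n ∸ i) * g (n ∸ i)))
        ≈⟨ sumTo-distrib-+ n _ _ ⟩
      B₁ + B₂ ∎

  ∂-^ˢ : ∀ (F : Series) a b → (∀ n → ∂ b F n ≈ oneˢ n + a * F n) →
         ∀ j n → ∂ b (F ^ˢ j) n ≈ ι j * ((F ^ˢ (j ∸ 1)) n + a * (F ^ˢ j) n)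
  ∂-^ˢ F a b ∂F zero zero =
    solve 2 (λ b a → (:1 :+ :0) :* :0 :+ b :* :0 :* :1 := :0 :* (:1 :+ a :* :1)) refl b a
  ∂-^ˢ F a b ∂F zero (suc n) =
    solve 3 (λ x y a → x :* :0 :+ y :* :0 := :0 :* (:0 :+ a :* :0)) refl (ι (suc (suc n))) (b * ι (suc n)) a
  ∂-^ˢ F a b ∂F (suc j) n = begin
    ∂ b (Fʲ ⊛ F) n  ≈⟨ ∂-leibniz b Fʲ F n ⟩
    (∂ b Fʲ ⊛ F) n + (Fʲ ⊛ ∂ b F) n
      ≈⟨ +-cong (⊛-congˡ n F (∂-^ˢ F a b ∂F j)) (⊛-congʳ n Fʲ ∂F) ⟩
    ((λ i → ι j * ((F ^ˢ (j ∸ 1)) i + a * Fʲ i)) ⊛ F) n + (Fʲ ⊛ (λ i → oneˢ i + a * F i)) n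
      ≈⟨ +-cong (trans (⊛-*ˡ n (ι j) _ F) (*-congˡ (trans (⊛-distribʳ-+ n _ _ F) (+-congˡ (⊛-*ˡ n a Fʲ F)))))
                (trans (⊛-distribˡ-+ n Fʲ oneˢ (λ i → a * F i)) (+-cong (⊛-identityʳ n Fʲ) (⊛-*ʳ n a Fʲ F))) ⟩
    ι j * (((F ^ˢ (j ∸ 1)) ⊛ F) n + a * Fʲ⁺¹) + (Fʲ n + a * Fʲ⁺¹)
      ≈⟨ +-congʳ (trans (distribˡ _ _ _) (+-congʳ (j*Fʲ j))) ⟩
    (ι j * Fʲ n + ι j * (a * Fʲ⁺¹)) + (Fʲ n + a * Fʲ⁺¹)
      ≈⟨ solve 4 (λ i u a q → (i :* u :+ i :* (a :* q)) :+ (u :+ a :* q) := (:1 :+ i) :* (u :+ a :* q)) refl (ι j) (Fʲ n) a Fʲ⁺¹ ⟩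
    ι (suc j) * (Fʲ n + a * Fʲ⁺¹) ∎
    where
    Fʲ = F ^ˢ j
    Fʲ⁺¹ = (Fʲ ⊛ F) n

    j*Fʲ : ∀ j → ι j * ((F ^ˢ (j ∸ 1)) ⊛ F) n ≈ ι j * (F ^ˢ j) n
    j*Fʲ zero    = trans (zeroˡ _) (sym (zeroˡ _))
    j*Fʲ (suc j) = refl

  ^ˢ-1 : ∀ (F : Series) n → (F ^ˢ 1) n ≈ F n
  ^ˢ-1 F zero    = *-identityˡ _
  ^ˢ-1 F (suc n) = begin
    (F ^ˢ 1) (suc n)                             ≈⟨ sumTo-suc n _ ⟩
    1# * F (suc n) + sumTo n (λ i → 0# * F (n ∸ i))  ≈⟨ +-cong (*-identityˡ _) (sumTo-zero n (λ i _ → zeroˡ _)) ⟩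
    F (suc n) + 0#                               ≈⟨ +-identityʳ _ ⟩
    F (suc n)                                    ∎

  ^ˢ-vanishes : ∀ (F : Series) → F 0 ≈ 0# → ∀ k n → n ℕ.< k → (F ^ˢ k) n ≈ 0#
  ^ˢ-vanishes F F0≈0 (suc k) n (s≤s n≤k) = sumTo-zero n term≈0
    where
    term≈0 : ∀ i → i ℕ.≤ n → (F ^ˢ k) i * F (n ∸ i) ≈ 0#
    term≈0 i i≤n with i ℕₚ.<? k
    ... | yes i<k = trans (*-congʳ (^ˢ-vanishes F F0≈0 k i i<k)) (zeroˡ _)
    ... | no  i≮k = trans (*-congˡ (trans (reflexive (≡.cong F (ℕₚ.m≤n⇒m∸n≡0 (ℕₚ.≤-trans n≤k (ℕₚ.≮⇒≥ i≮k))))) F0≈0))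
                          (zeroʳ _)

  ^ˢ-at-zero : ∀ (F : Series) → F 0 ≈ 0# → ∀ k → (F ^ˢ k) 0 ≈ δ k 0
  ^ˢ-at-zero F F0≈0 zero    = refl
  ^ˢ-at-zero F F0≈0 (suc k) = trans (*-congˡ F0≈0) (zeroʳ _)

  module _ (*-inverseʳ : ∀ x → ¬ (x ≈ 0#) → x * inv x ≈ 1#)
           (ι-suc-nonzero : ∀ n → ¬ (ι (suc n) ≈ 0#)) where

    *-inverseˡ : ∀ x → ¬ (x ≈ 0#) → inv x * x ≈ 1#
    *-inverseˡ x x≉0 = trans (*-comm _ _) (*-inverseʳ x x≉0)

    inv-unique : ∀ x y → ¬ (x ≈ 0#) → x * y ≈ 1# → y ≈ inv x
    inv-unique x y x≉0 xy≈1 = begin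
      y                ≈⟨ *-identityʳ _ ⟨
      y * 1#           ≈⟨ *-congˡ (*-inverseʳ x x≉0) ⟨
      y * (x * inv x)  ≈⟨ solve 3 (λ y x i → y :* (x :* i) := (x :* y) :* i) refl y x (inv x) ⟩
      (x * y) * inv x  ≈⟨ *-congʳ xy≈1 ⟩
      1# * inv x       ≈⟨ *-identityˡ _ ⟩
      inv x            ∎

    *-nonzero : ∀ {x y} → ¬ (x ≈ 0#) → ¬ (y ≈ 0#) → ¬ (x * y ≈ 0#)
    *-nonzero {x} {y} x≉0 y≉0 xy≈0 = y≉0 (begin
      y                ≈⟨ *-identityˡ _ ⟨
      1# * y           ≈⟨ *-congʳ (*-inverseˡ x x≉0) ⟨
      (inv x * x) * y  ≈⟨ *-assoc _ _ _ ⟩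
      inv x * (x * y)  ≈⟨ *-congˡ xy≈0 ⟩
      inv x * 0#       ≈⟨ zeroʳ _ ⟩
      0#               ∎)

    1≉0 : ¬ (1# ≈ 0#)
    1≉0 1≈0 = ι-suc-nonzero 0 (trans (+-identityʳ 1#) 1≈0)

    fact-nonzero : ∀ n → ¬ (fact n ≈ 0#)
    fact-nonzero zero    = 1≉0
    fact-nonzero (suc n) = *-nonzero (fact-nonzero n) (ι-suc-nonzero n)

    inv-distrib-* : ∀ x y → ¬ (x ≈ 0#) → ¬ (y ≈ 0#) → inv (x * y) ≈ inv x * inv y
    inv-distrib-* x y x≉0 y≉0 = sym (inv-unique (x * y) (inv x * inv y) (*-nonzero x≉0 y≉0) (begin
      (x * y) * (inv x * inv y)  ≈⟨ solve 4 (λ x y x′ y′ → (x :* y) :* (x′ :* y′) := (x :* x′) :* (y :* y′)) refl x y (inv x) (inv y) ⟩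
      (x * inv x) * (y * inv y)  ≈⟨ *-cong (*-inverseʳ x x≉0) (*-inverseʳ y y≉0) ⟩
      1# * 1#                    ≈⟨ *-identityʳ 1# ⟩
      1#                         ∎))

    inv-1 : inv 1# ≈ 1#
    inv-1 = sym (inv-unique 1# 1# 1≉0 (*-identityʳ 1#))

    ι-suc-cancel : ∀ n {x y} → ι (suc n) * x ≈ ι (suc n) * y → x ≈ y
    ι-suc-cancel n {x} {y} e = begin
      x              ≈⟨ *-identityˡ _ ⟨
      1# * x         ≈⟨ *-congʳ (*-inverseˡ _ (ι-suc-nonzero n)) ⟨
      (i * ι (suc n)) * x  ≈⟨ *-assoc _ _ _ ⟩
      i * (ι (suc n) * x)  ≈⟨ *-congˡ e ⟩
      i * (ι (suc n) * y)  ≈⟨ *-assoc _ _ _ ⟨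
      (i * ι (suc n)) * y  ≈⟨ *-congʳ (*-inverseˡ _ (ι-suc-nonzero n)) ⟩
      1# * y         ≈⟨ *-identityˡ _ ⟩
      y              ∎
      where i = inv (ι (suc n))

    -- Σₖ [tᵏ] Fʲ · [tⁿ] Gᵏ is the coefficient of tⁿ in F(G(t))ʲ, and the two
    -- differential equations force F(G(t)) = t.
    module Composition (a b : Carrier) (F G : Series) (F0≈0 : F 0 ≈ 0#) (G0≈0 : G 0 ≈ 0#)
                       (∂F : ∀ n → ∂ b F n ≈ oneˢ n + a * F n)
                       (∂G : ∀ n → ∂ a G n ≈ oneˢ n + b * G n) where

      P Q : ℕ → ℕ → Carrier
      P j k = (F ^ˢ j) k
      Q k n = (G ^ˢ k) n

      compose : ℕ → ℕ → Carrier
      compose n j = sumTo n (λ k → P j k * Q k n)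

      private
        isolate : ∀ {x y z} → x + y ≈ z → x ≈ z - y
        isolate {x} {y} {z} e = trans (solve 2 (λ x y → x := (x :+ y) :- y) refl x y) (+-congʳ e)

        summand-step : ∀ n j k →
          ι (suc k) * P j (suc k) * Q k n + (b * ι k - a * ι n) * P j k * Q k n
            ≈ ι j * (P (j ∸ 1) k * Q k n) + a * (ι j - ι n) * (P j k * Q k n)
        summand-step n j k = begin
          ι (suc k) * P j (suc k) * Q k n + (b * ι k - a * ι n) * P j k * Q k n
            ≈⟨ +-congʳ (*-congʳ (isolate (∂-^ˢ F a b ∂F j k))) ⟩
          (ι j * (P (j ∸ 1) k + a * P j k) - b * ι k * P j k) * Q k n + (b * ι k - a * ι n) * P j k * Q k n
            ≈⟨ solve 8 (λ ij p₁ a p b ik q in′ →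
                 (ij :* (p₁ :+ a :* p) :- b :* ik :* p) :* q :+ (b :* ik :- a :* in′) :* p :* q
                 := ij :* (p₁ :* q) :+ a :* (ij :- in′) :* (p :* q)) refl
                 (ι j) (P (j ∸ 1) k) a (P j k) b (ι k) (Q k n) (ι n) ⟩
          ι j * (P (j ∸ 1) k * Q k n) + a * (ι j - ι n) * (P j k * Q k n) ∎

        δ-step : ∀ n j → ι j * δ n (j ∸ 1) + a * (ι j - ι n) * δ n j ≈ ι (suc n) * δ (suc n) j
        δ-step n zero = begin
          0# * δ n 0 + a * (0# - ι n) * δ n 0  ≈⟨ +-cong (zeroˡ _) (δ-subst (λ m → a * (0# - ι m)) n 0) ⟩
          0# + a * (0# - 0#) * δ n 0           ≈⟨ solve 2 (λ a d → :0 :+ a :* (:0 :- :0) :* d := :0) refl a (δ n 0) ⟩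
          0#                                   ≈⟨ zeroʳ _ ⟨
          ι (suc n) * 0#                       ∎
        δ-step n (suc j) = begin
          ι (suc j) * δ n j + a * (ι (suc j) - ι n) * δ n (suc j)
            ≈⟨ +-cong (sym (δ-subst (λ m → ι (suc m)) n j)) (δ-subst (λ m → a * (ι (suc j) - ι m)) n (suc j)) ⟩
          ι (suc n) * δ n j + a * (ι (suc j) - ι (suc j)) * δ n (suc j)
            ≈⟨ solve 5 (λ x d a y e → x :* d :+ a :* (y :- y) :* e := x :* d) refl (ι (suc n)) (δ n j) a (ι (suc j)) (δ n (suc j)) ⟩
          ι (suc n) * δ n j ∎

      compose≈δ : ∀ n j → compose n j ≈ δ n j
      compose≈δ zero j = begin
        P j 0 * Q 0 0  ≈⟨ *-congʳ (^ˢ-at-zero F F0≈0 j) ⟩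
        δ j 0 * 1#     ≈⟨ *-identityʳ _ ⟩
        δ j 0          ≈⟨ δ-sym j 0 ⟩
        δ 0 j          ∎
      compose≈δ (suc n) j = ι-suc-cancel n (begin
        ι (suc n) * compose (suc n) j  ≈⟨ sumTo-*ˡ (suc n) _ _ ⟨
        sumTo (suc n) (λ k → ι (suc n) * (P j k * Q k (suc n)))
          ≈⟨ sumTo-cong (suc n) (λ k _ → trans (solve 3 (λ x p q → x :* (p :* q) := p :* (x :* q)) refl _ _ _)
                (*-congˡ (isolate (∂-^ˢ G b a ∂G k n)))) ⟩
        sumTo (suc n) (λ k → P j k * (ι k * (Q (k ∸ 1) n + b * Q k n) - a * ι n * Q k n))
          ≈⟨ sumTo-cong (suc n) (λ k _ → solve 7 (λ p ik q₁ b q a i → p :* (ik :* (q₁ :+ b :* q) :- a :* i :* q)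
                   := ik :* p :* q₁ :+ (b :* ik :- a :* i) :* p :* q) refl (P j k) (ι k) (Q (k ∸ 1) n) b (Q k n) a (ι n)) ⟩
        sumTo (suc n) (λ k → ι k * P j k * Q (k ∸ 1) n + (b * ι k - a * ι n) * P j k * Q k n)
          ≈⟨ sumTo-distrib-+ (suc n) _ _ ⟩
        sumTo (suc n) (λ k → ι k * P j k * Q (k ∸ 1) n) + sumTo (suc n) (λ k → (b * ι k - a * ι n) * P j k * Q k n)
          ≈⟨ +-cong (sumTo-suc-vanishing-head n _ (trans (*-assoc _ _ _) (zeroˡ _)))
                    (sumTo-vanishing-last n _ (trans (*-congˡ (^ˢ-vanishes G G0≈0 (suc n) n ℕₚ.≤-refl)) (zeroʳ _))) ⟩
        sumTo n (λ k → ι (suc k) * P j (suc k) * Q k n) + sumTo n (λ k → (b * ι k - a * ι n) * P j k * Q k n)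
          ≈⟨ sumTo-distrib-+ n _ _ ⟨
        sumTo n (λ k → ι (suc k) * P j (suc k) * Q k n + (b * ι k - a * ι n) * P j k * Q k n)
          ≈⟨ sumTo-cong n (λ k _ → summand-step n j k) ⟩
        sumTo n (λ k → ι j * (P (j ∸ 1) k * Q k n) + a * (ι j - ι n) * (P j k * Q k n))
          ≈⟨ sumTo-distrib-+ n _ _ ⟩
        sumTo n (λ k → ι j * (P (j ∸ 1) k * Q k n)) + sumTo n (λ k → a * (ι j - ι n) * (P j k * Q k n))
          ≈⟨ +-cong (sumTo-*ˡ n _ _) (sumTo-*ˡ n _ _) ⟩
        ι j * compose n (j ∸ 1) + a * (ι j - ι n) * compose n j
          ≈⟨ +-cong (*-congˡ (compose≈δ n (j ∸ 1))) (*-congˡ (compose≈δ n j)) ⟩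
        ι j * δ n (j ∸ 1) + a * (ι j - ι n) * δ n j
          ≈⟨ δ-step n j ⟩
        ι (suc n) * δ (suc n) j ∎)

    eˣ-recurrence : ∀ μ x n → ι (suc n) * eˣ μ x (suc n) ≈ eˣ μ x n * (x - ι n * μ)
    eˣ-recurrence μ x n = begin
      ι (suc n) * ((fall x μ n * d) * inv (fact n * ι (suc n)))
        ≈⟨ *-congˡ (*-congˡ (inv-distrib-* (fact n) (ι (suc n)) (fact-nonzero n) (ι-suc-nonzero n))) ⟩
      ι (suc n) * ((fall x μ n * d) * (inv (fact n) * inv (ι (suc n))))
        ≈⟨ solve 5 (λ s f d a b → s :* ((f :* d) :* (a :* b)) := ((f :* a) :* d) :* (s :* b)) refl
             (ι (suc n)) (fall x μ n) d (inv (fact n)) (inv (ι (suc n))) ⟩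
      (eˣ μ x n * d) * (ι (suc n) * inv (ι (suc n)))
        ≈⟨ *-congˡ (*-inverseʳ _ (ι-suc-nonzero n)) ⟩
      (eˣ μ x n * d) * 1#
        ≈⟨ *-identityʳ _ ⟩
      eˣ μ x n * d ∎
      where d = x - ι n * μ

    eˣ-zero : ∀ μ x → eˣ μ x 0 ≈ 1#
    eˣ-zero μ x = trans (*-identityˡ _) inv-1

    eˣ-one : ∀ μ x → ι 1 * eˣ μ x 1 ≈ x
    eˣ-one μ x = trans (eˣ-recurrence μ x 0) (trans (*-congʳ (eˣ-zero μ x))
      (solve 2 (λ x μ → :1 :* (x :- :0 :* μ) := x) refl x μ))

    module _ (lam : Carrier) (lam≉0 : ¬ (lam ≈ 0#)) where

      E L E/t : Series
      E = eMinus1 lam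
      L = logλ lam
      E/t m = E (suc m)

      E-∂ : ∀ n → ∂ lam E n ≈ oneˢ n + 1# * E n
      E-∂ zero = begin
        ι 1 * eˣ lam 1# 1 + lam * 0# * 0#  ≈⟨ +-congʳ (eˣ-one lam 1#) ⟩
        1# + lam * 0# * 0#                 ≈⟨ solve 1 (λ l → :1 :+ l :* :0 :* :0 := :1 :+ :1 :* :0) refl lam ⟩
        1# + 1# * 0#                       ∎
      E-∂ (suc m) = begin
        ι (suc (suc m)) * eˣ lam 1# (suc (suc m)) + lam * ι (suc m) * e
          ≈⟨ +-congʳ (eˣ-recurrence lam 1# (suc m)) ⟩
        e * (1# - ι (suc m) * lam) + lam * ι (suc m) * e
          ≈⟨ solve 3 (λ e i l → e :* (:1 :- i :* l) :+ l :* i :* e := :0 :+ :1 :* e) refl e (ι (suc m)) lam ⟩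
        0# + 1# * e ∎
        where e = eˣ lam 1# (suc m)

      L-∂ : ∀ n → ∂ 1# L n ≈ oneˢ n + lam * L n
      L-∂ zero = begin
        ι 1 * (inv lam * eˣ 1# lam 1) + 1# * 0# * 0#
          ≈⟨ solve 4 (λ a b c d → a :* (b :* c) :+ d := b :* (a :* c) :+ d) refl (ι 1) (inv lam) (eˣ 1# lam 1) (1# * 0# * 0#) ⟩
        inv lam * (ι 1 * eˣ 1# lam 1) + 1# * 0# * 0#
          ≈⟨ +-congʳ (*-congˡ (eˣ-one 1# lam)) ⟩
        inv lam * lam + 1# * 0# * 0#
          ≈⟨ +-cong (*-inverseˡ lam lam≉0) (solve 0 (:1 :* :0 :* :0 := :0) refl) ⟩
        1# + 0#
          ≈⟨ +-congˡ (zeroʳ lam) ⟨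
        1# + lam * 0# ∎
      L-∂ (suc m) = begin
        ι (suc (suc m)) * (inv lam * eˣ 1# lam (suc (suc m))) + 1# * ι (suc m) * (inv lam * e)
          ≈⟨ +-congʳ (trans (solve 3 (λ a b c → a :* (b :* c) := b :* (a :* c)) refl _ _ _)
                            (*-congˡ (eˣ-recurrence 1# lam (suc m)))) ⟩
        inv lam * (e * (lam - ι (suc m) * 1#)) + 1# * ι (suc m) * (inv lam * e)
          ≈⟨ solve 4 (λ i e l k → i :* (e :* (l :- k :* :1)) :+ :1 :* k :* (i :* e) := :0 :+ l :* (i :* e))
               refl (inv lam) e lam (ι (suc m)) ⟩
        0# + lam * (inv lam * e) ∎
        where e = eˣ 1# lam (suc m)

      module E∘L = Composition 1# lam E L refl refl E-∂ L-∂
      module L∘E = Composition lam 1# L E refl refl L-∂ E-∂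

      -- L(s)/s at s = E(t), that is, t/(e_λ(t) − 1).
      bernoulliˢ : Series
      bernoulliˢ n = sumTo n (λ k → L (suc k) * (E ^ˢ k) n)

      bernoulliˢ-pairing : ∀ n (X : ℕ → Carrier) →
        sumTo n (λ i → bernoulliˢ i * X i) ≈ sumTo n (λ k → L (suc k) * sumTo n (λ i → (E ^ˢ k) i * X i))
      bernoulliˢ-pairing n X = begin
        sumTo n (λ i → bernoulliˢ i * X i)
          ≈⟨ sumTo-cong n (λ i _ → sumTo-*ʳ i _ _) ⟨
        sumTo n (λ i → sumTo i (λ k → L (suc k) * (E ^ˢ k) i * X i))
          ≈⟨ sumTo-triangle n (λ k i → L (suc k) * (E ^ˢ k) i * X i)
               (λ k i i<k → trans (*-congʳ (trans (*-congˡ (^ˢ-vanishes E refl k i i<k)) (zeroʳ _))) (zeroˡ _)) ⟩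
        sumTo n (λ i → sumTo n (λ k → L (suc k) * (E ^ˢ k) i * X i))
          ≈⟨ sumTo-comm n n _ ⟩
        sumTo n (λ k → sumTo n (λ i → L (suc k) * (E ^ˢ k) i * X i))
          ≈⟨ sumTo-cong n (λ k _ → trans (sumTo-cong n (λ i _ → *-assoc _ _ _)) (sumTo-*ˡ n _ _)) ⟩
        sumTo n (λ k → L (suc k) * sumTo n (λ i → (E ^ˢ k) i * X i)) ∎

      ^ˢ-⊛-E/t : ∀ k n → ((E ^ˢ k) ⊛ E/t) n ≈ (E ^ˢ suc k) (suc n)
      ^ˢ-⊛-E/t k n = sym (trans (⊛-suc n (E ^ˢ k) E) (trans (+-congˡ (zeroʳ _)) (+-identityʳ _)))

      bernoulliˢ-⊛-E/t : ∀ n → (bernoulliˢ ⊛ E/t) n ≈ oneˢ n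
      bernoulliˢ-⊛-E/t n = begin
        (bernoulliˢ ⊛ E/t) n
          ≈⟨ bernoulliˢ-pairing n (λ i → E/t (n ∸ i)) ⟩
        sumTo n (λ k → L (suc k) * ((E ^ˢ k) ⊛ E/t) n)
          ≈⟨ sumTo-cong n (λ k _ → *-cong (sym (^ˢ-1 L (suc k))) (^ˢ-⊛-E/t k n)) ⟩
        sumTo n (λ k → (L ^ˢ 1) (suc k) * (E ^ˢ suc k) (suc n))
          ≈⟨ sumTo-suc-vanishing-head n _ (zeroʳ _) ⟨
        L∘E.compose (suc n) 1
          ≈⟨ L∘E.compose≈δ (suc n) 1 ⟩
        δ n 0
          ≈⟨ δ-zero n ⟩
        oneˢ n ∎

      bernoulliˢ-∘-L : ∀ n → sumTo n (λ k → bernoulliˢ k * (L ^ˢ k) n) ≈ L (suc n)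
      bernoulliˢ-∘-L n = begin
        sumTo n (λ k → bernoulliˢ k * (L ^ˢ k) n)
          ≈⟨ bernoulliˢ-pairing n (λ k → (L ^ˢ k) n) ⟩
        sumTo n (λ j → L (suc j) * E∘L.compose n j)
          ≈⟨ sumTo-cong n (λ j _ → *-congˡ (E∘L.compose≈δ n j)) ⟩
        sumTo n (λ j → L (suc j) * δ n j)
          ≈⟨ sumTo-δ n _ ⟩
        L (suc n) ∎

      E/t-0 : E/t 0 ≈ 1#
      E/t-0 = ι-suc-cancel 0 (trans (eˣ-one lam 1#) (sym (trans (*-identityʳ _) (+-identityʳ 1#))))

      fall-rescale : ∀ m → fall lam 1# m ≈ pow lam m * fall 1# (inv lam) m
      fall-rescale zero    = sym (*-identityʳ _)
      fall-rescale (suc m) = begin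
        fall lam 1# m * (lam - ι m * 1#)        ≈⟨ *-congʳ (fall-rescale m) ⟩
        (p * f) * (lam - ι m * 1#)              ≈⟨ *-congˡ (+-congˡ (-‿cong (*-congˡ (sym (*-inverseʳ lam lam≉0))))) ⟩
        (p * f) * (lam - ι m * (lam * inv lam))
          ≈⟨ solve 5 (λ p f l i k → (p :* f) :* (l :- k :* (l :* i)) := (p :* l) :* (f :* (:1 :- k :* i)))
               refl p f lam (inv lam) (ι m) ⟩
        (p * lam) * (f * (1# - ι m * inv lam))  ∎
        where
        p = pow lam m
        f = fall 1# (inv lam) m

      L-coefficient : ∀ k → L (suc k) ≈ pow lam k * fall 1# (inv lam) (suc k) * inv (ι (suc k)) * inv (fact k)
      L-coefficient k = begin
        inv lam * (fall lam 1# (suc k) * inv (fact k * ι (suc k)))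
          ≈⟨ *-congˡ (*-cong (fall-rescale (suc k)) (inv-distrib-* (fact k) (ι (suc k)) (fact-nonzero k) (ι-suc-nonzero k))) ⟩
        inv lam * ((pow lam k * lam * f) * (inv (fact k) * inv (ι (suc k))))
          ≈⟨ solve 6 (λ i p l f a b → i :* ((p :* l :* f) :* (a :* b)) := (l :* i) :* (p :* f :* b :* a)) refl
               (inv lam) (pow lam k) lam f (inv (fact k)) (inv (ι (suc k))) ⟩
        (lam * inv lam) * (pow lam k * f * inv (ι (suc k)) * inv (fact k))
          ≈⟨ trans (*-congʳ (*-inverseʳ lam lam≉0)) (*-identityˡ _) ⟩
        pow lam k * f * inv (ι (suc k)) * inv (fact k) ∎
        where f = fall 1# (inv lam) (suc k)

      fact-*-/fact : ∀ n x → fact n * (x * inv (fact n)) ≈ x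
      fact-*-/fact n x = begin
        fact n * (x * inv (fact n))  ≈⟨ solve 3 (λ f x i → f :* (x :* i) := x :* (f :* i)) refl (fact n) x (inv (fact n)) ⟩
        x * (fact n * inv (fact n))  ≈⟨ *-congˡ (*-inverseʳ _ (fact-nonzero n)) ⟩
        x * 1#                       ≈⟨ *-identityʳ x ⟩
        x                            ∎

      module _ (β : ℕ → Carrier) (β-bernoulli : IsDegBernoulli lam β) where

        β/fact≈bernoulliˢ : ∀ n → β n * inv (fact n) ≈ bernoulliˢ n
        β/fact≈bernoulliˢ =
          ⊛-cancelʳ _ bernoulliˢ E/t E/t-0 (λ n → trans (β-bernoulli n) (sym (bernoulliˢ-⊛-E/t n)))

        β-via-S₂ : ∀ n → β n ≈ sumTo n (λ k → pow lam k * fall 1# (inv lam) (suc k) * inv (ι (suc k)) * S₂ lam n k)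
        β-via-S₂ n = begin
          β n                                    ≈⟨ fact-*-/fact n (β n) ⟨
          fact n * (β n * inv (fact n))          ≈⟨ *-congˡ (β/fact≈bernoulliˢ n) ⟩
          fact n * bernoulliˢ n                  ≈⟨ sumTo-*ˡ n _ _ ⟨
          sumTo n (λ k → fact n * (L (suc k) * (E ^ˢ k) n))
            ≈⟨ sumTo-cong n (λ k _ → trans (*-congˡ (*-congʳ (L-coefficient k)))
                 (solve 4 (λ F c a g → F :* ((c :* a) :* g) := c :* (F :* (a :* g))) refl
                   (fact n) (pow lam k * fall 1# (inv lam) (suc k) * inv (ι (suc k))) (inv (fact k)) ((E ^ˢ k) n))) ⟩
          sumTo n (λ k → pow lam k * fall 1# (inv lam) (suc k) * inv (ι (suc k)) * S₂ lam n k) ∎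

        S₁-sum-of-β : ∀ n → fall 1# (inv lam) (suc n) * inv (ι (suc n)) * pow lam n ≈ sumTo n (λ k → β k * S₁ lam n k)
        S₁-sum-of-β n = sym (begin
          sumTo n (λ k → β k * S₁ lam n k)
            ≈⟨ sumTo-cong n (λ k _ → trans
                 (solve 4 (λ x F a g → x :* (F :* (a :* g)) := F :* ((x :* a) :* g)) refl (β k) (fact n) (inv (fact k)) ((L ^ˢ k) n))
                 (*-congˡ (*-congʳ (β/fact≈bernoulliˢ k)))) ⟩
          sumTo n (λ k → fact n * (bernoulliˢ k * (L ^ˢ k) n))  ≈⟨ sumTo-*ˡ n _ _ ⟩
          fact n * sumTo n (λ k → bernoulliˢ k * (L ^ˢ k) n)    ≈⟨ *-congˡ (trans (bernoulliˢ-∘-L n) (L-coefficient n)) ⟩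
          fact n * (pow lam n * f * inv (ι (suc n)) * inv (fact n))
            ≈⟨ *-congˡ (*-congʳ (solve 3 (λ p f i → p :* f :* i := f :* i :* p) refl (pow lam n) f (inv (ι (suc n))))) ⟩
          fact n * (f * inv (ι (suc n)) * pow lam n * inv (fact n))
            ≈⟨ fact-*-/fact n _ ⟩
          f * inv (ι (suc n)) * pow lam n ∎)
          where f = fall 1# (inv lam) (suc n)

theorem4 : {c ℓ : Level} (R : CommutativeRing c ℓ) →
    let open CommutativeRing R
        open Degenerate R
    in (inv : Carrier → Carrier) →
       (∀ x → ¬ (x ≈ 0#) → x * inv x ≈ 1#) →
       (∀ n → ¬ (ι inv (suc n) ≈ 0#)) →
       (lam : Carrier) → ¬ (lam ≈ 0#) →
       (β : ℕ → Carrier) → IsDegBernoulli inv lam β →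
       (n : ℕ) →
       (β n ≈ sumTo inv n (λ k → pow inv lam k * fall inv 1# (inv lam) (suc k)
                                 * inv (ι inv (suc k)) * S₂ inv lam n k))
       × (fall inv 1# (inv lam) (suc n) * inv (ι inv (suc n)) * pow inv lam n
          ≈ sumTo inv n (λ k → β k * S₁ inv lam n k))
theorem4 R inv *-inverseʳ ι-suc-nonzero lam lam≉0 β β-bernoulli n =
    β-via-S₂ R inv *-inverseʳ ι-suc-nonzero lam lam≉0 β β-bernoulli n
  , S₁-sum-of-β R inv *-inverseʳ ι-suc-nonzero lam lam≉0 β β-bernoulli n
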